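{- Let $\mu$ be a countable ordinal and $w$ a $(\mu+1)$-biworld. If $A^w\cap\bar A^w=\emptyset$ for every agent $A\in\mathcal{A}$, then $w$ is completed.
   Context: All ordinals are countable. Fix a propositional vocabulary $\Sigma$ and a set $\mathcal{A}$ of agents. The following notions are defined by simultaneous transfinite recursion. A $0$-prebiworld is an interpretation $I\subseteq\Sigma$; its objective interpretation is $I$. A $(\mu+1)$-prebiworld is a triple $w=(I,(A^w)_{A\in\mathcal{A}},(\bar A^w)_{A\in\mathcal{A}})$ with $I\subseteq\Sigma$ and each $A^w,\bar A^w$ a set of $\mu$-prebiworlds; its objective interpretation is $I$. For a limit ordinal $\lambda$, a $\lambda$-prebiworld is a sequence $w=((w)_\gamma)_{\gamma<\lambda}$ where each $(w)_\gamma$ is a $\gamma$-prebiworld and $(w)_\delta\le_p(w)_\gamma$ whenever $\delta\le\gamma<\lambda$; its objective interpretation is $(w)_0$. For a $\mu$-prebiworld $w$ and $\gamma\le\mu$, the restriction $w|_\gamma$ is the $\gamma$-prebiworld defined by: $w|_0$ is the objective interpretation of $w$; if $\gamma$ is a limit, $w|_\gamma=(w|_\delta)_{\delta<\gamma}$; if $\gamma=\gamma'+1$ and $\mu$ is a limit, $w|_\gamma=(w)_\gamma$; if $\gamma=\gamma'+1$ and $\mu=\mu''+1$, then $w|_\gamma$ has the same objective interpretation as $w$, $A^{w|_\gamma}=\{v|_{\gamma'}:v\in A^w\}$ and $\bar A^{w|_\gamma}=\{v|_{\gamma'}:v\in\bar A^w\}$. For a $\gamma$-prebiworld $v$ and a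 $\mu$-prebiworld $w$ with $\gamma\le\mu$, write $v\le_p w$ iff $w|_\gamma=v$. A $\mu$-prebiworld $w$ is incompleted if there are two distinct $(\mu+1)$-biworlds $u_1,u_2$ with $w\le_p u_1$ and $w\le_p u_2$; otherwise it is completed. A $\mu$-biworld is a $\mu$-prebiworld $w$ such that either $\mu=0$; or $\mu=\mu''+1$ and for every agent $A$, $A^w\cup\bar A^w$ equals the set of all $\mu''$-biworlds and every element of $A^w\cap\bar A^w$ is incompleted; or $\mu$ is a limit and $(w)_\gamma$ is a $\gamma$-biworld for every $\gamma<\mu$. (At each stage $\mu$, once the $\mu$-biworlds are determined, the set of incompleted $\mu$-prebiworlds and the set of $(\mu+1)$-biworlds are the least sets satisfying these two mutually dependent conditions.) -}

module Defs where

open import Level using (Level; 0ℓ; Lift) renaming (suc to lsuc)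
open import Data.Nat using (ℕ)
open import Data.Empty using (⊥)
open import Data.Unit using (⊤)
open import Data.Product using (Σ; _×_; _,_; proj₁)
open import Data.Sum using (_⊎_; [_,_]′)
open import Relation.Nullary using (¬_)
open import Relation.Unary using (Pred; _≐_)
open import Relation.Binary.Definitions using (Transitive; Trichotomous)
open import Relation.Binary.PropositionalEquality using (_≡_; subst; sym)
open import Induction.WellFounded using (WellFounded; WfRec; module All)

-- Every such structure is
-- (classically) isomorphic to a limit ordinal ≤ ω₁, i.e. an initial
-- segment of the countable ordinals closed under successor, and the
-- countable ordinals themselves form such a structure.

record CountableOrdinals : Set₁ where
  field
    Ord       : Set
    _<_       : Ord → Ord → Set
    <-trans   : Transitive _<_
    <-tri     : Trichotomous _≡_ _<_
    <-wf      : WellFounded _<_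
    zero      : Ord
    zero-min  : ∀ a → ¬ (a < zero)
    suc       : Ord → Ord
    <-suc     : ∀ a → a < suc a
    suc-least : ∀ a b → a < b → (suc a < b) ⊎ (suc a ≡ b)
    countable : ∀ a → Σ (Σ Ord (λ b → b < a) → ℕ)
                        (λ f → ∀ x y → f x ≡ f y → proj₁ x ≡ proj₁ y)

  _≤_ : Ord → Ord → Set
  a ≤ b = (a < b) ⊎ (a ≡ b)

  IsLimit : Ord → Set
  IsLimit l = ¬ (l ≡ zero) × (∀ b → ¬ (l ≡ suc b))

-- V  : the propositional vocabulary Σ;   Ag : the set of agents 𝒜.

module Worlds (O : CountableOrdinals) (V : Set) (Ag : Set) where
  open CountableOrdinals O

  -- Sets of prebiworlds are
  -- represented as families  K → Raw  (membership/equality up to the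
  -- extensional equality of prebiworlds defined below).
  --   base I               : a 0-prebiworld I ⊆ Σ
  --   node I KA fA KB fB   : a successor prebiworld (I, (A^w)_A, (Ā^w)_A)
  --                          with A^w = {fA A k | k : KA A}, Ā^w = {fB A k | k : KB A}
  --   seq l h              : a l-prebiworld for a limit l, (w)_γ = h γ _
  data Raw : Set₁ where
    base : Pred V 0ℓ → Raw
    node : Pred V 0ℓ →
           (KA : Ag → Set) → ((a : Ag) → KA a → Raw) →
           (KB : Ag → Set) → ((a : Ag) → KB a → Raw) → Raw
    seq  : (l : Ord) → ((γ : Ord) → γ < l → Raw) → Raw

  -- Res γ w v  :⇔  w|γ = v   (i.e. v ≤ₚ w, with v a γ-prebiworld).
  -- For a γ-prebiworld w, Res γ w v is equality of γ-prebiworlds.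
  data Res : Ord → Raw → Raw → Set₁ where
    res-zero-base : ∀ {γ I J} → γ ≡ zero → I ≐ J → Res γ (base I) (base J)
    res-zero-node : ∀ {γ I KA fA KB fB J} → γ ≡ zero → I ≐ J →
                    Res γ (node I KA fA KB fB) (base J)
    res-zero-seq  : ∀ {γ l h J} → γ ≡ zero → (p : zero < l) →
                    Res zero (h zero p) (base J) → Res γ (seq l h) (base J)
    res-lim       : ∀ {γ w g} → IsLimit γ →
                    (∀ δ (p : δ < γ) → Res δ w (g δ p)) → Res γ w (seq γ g)
    res-suc-seq   : ∀ {γ γ' l h v} → γ ≡ suc γ' → (p : γ < l) →
                    Res γ (h γ p) v → Res γ (seq l h) v
    res-suc-node  : ∀ {γ γ' I KA fA KB fB J KA' fA' KB' fB'} → γ ≡ suc γ' → I ≐ J →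
                    (∀ a → (∀ k → Σ (KA' a) λ k' → Res γ' (fA a k) (fA' a k'))
                         × (∀ k' → Σ (KA a) λ k → Res γ' (fA a k) (fA' a k'))) →
                    (∀ a → (∀ k → Σ (KB' a) λ k' → Res γ' (fB a k) (fB' a k'))
                         × (∀ k' → Σ (KB a) λ k → Res γ' (fB a k) (fB' a k'))) →
                    Res γ (node I KA fA KB fB) (node J KA' fA' KB' fB')

  data IsPW : Ord → Raw → Set₁ where
    pw-zero : ∀ {α I} → α ≡ zero → IsPW α (base I)
    pw-suc  : ∀ {α β I KA fA KB fB} → α ≡ suc β →
              (∀ a k → IsPW β (fA a k)) → (∀ a k → IsPW β (fB a k)) →
              IsPW α (node I KA fA KB fB)
    pw-lim  : ∀ {l h} → IsLimit l → (∀ γ p → IsPW γ (h γ p)) →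
              (∀ δ γ (p : δ < l) (q : γ < l) → δ ≤ γ → Res δ (h γ q) (h δ p)) →
              IsPW l (seq l h)

  -- Stage β: given the set B of β-biworlds, the incompleted β-prebiworlds
  -- (Inc) and the (β+1)-biworlds (BiSucc, together with IsPW (suc β)) are
  -- the least sets satisfying the two mutually dependent conditions.
  module Stage (β : Ord) (B : Raw → Set₁) where
    data BiSucc : Raw → Set₁
    data Inc : Raw → Set₁

    data BiSucc where
      bisucc : ∀ {I KA fA KB fB} →
               -- A^w ∪ Ā^w equals the set of all β-biworlds
               (∀ a → (∀ y → B y → Σ (KA a ⊎ KB a) λ k → Res β ([ fA a , fB a ]′ k) y)
                    × (∀ k → Σ Raw λ y → B y × Res β ([ fA a , fB a ]′ k) y)) →
               (∀ a k k' → Res β (fA a k) (fB a k') → Inc (fA a k)) →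
               BiSucc (node I KA fA KB fB)

    data Inc where
      inc : ∀ {x} u₁ u₂ →
            IsPW (suc β) u₁ → BiSucc u₁ → Res β u₁ x →
            IsPW (suc β) u₂ → BiSucc u₂ → Res β u₂ x →
            ¬ Res (suc β) u₁ u₂ → Inc x

  private
    lt : ∀ {α β} → α ≡ suc β → β < α
    lt {β = β} e = subst (β <_) (sym e) (<-suc β)

    LimCond : (α : Ord) → WfRec _<_ (λ _ → Raw → Set₁) α → Raw → Set₁
    LimCond α IH (seq l h) = ∀ γ (p : γ < α) (q : γ < l) → IH p (h γ q)
    LimCond α IH _         = Lift (lsuc 0ℓ) ⊥

    step : (α : Ord) → WfRec _<_ (λ _ → Raw → Set₁) α → Raw → Set₁
    step α IH w = IsPW α w ×
      (  Lift (lsuc 0ℓ) (α ≡ zero)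
       ⊎ (Σ Ord λ β → Σ (α ≡ suc β) λ e → Stage.BiSucc β (IH (lt e)) w)
       ⊎ (Lift (lsuc 0ℓ) (IsLimit α) × LimCond α IH w))

  Biworld : Ord → Raw → Set₁
  Biworld = All.wfRec <-wf (lsuc (lsuc 0ℓ)) (λ _ → Raw → Set₁) step

  Incompleted : Ord → Raw → Set₁
  Incompleted α = Stage.Inc α (Biworld α)

  Completed : Ord → Raw → Set₁
  Completed α w = ¬ Incompleted α w

  AgentsDisjoint : Ord → Raw → Set₁
  AgentsDisjoint μ (node I KA fA KB fB) = ∀ a k k' → ¬ Res μ (fA a k) (fB a k')
  AgentsDisjoint μ _                    = Lift (lsuc 0ℓ) ⊤

-- If u₁, u₂ are (μ+2)-biworlds restricting to w, a member x of A^{u₁} is a (μ+1)-biworld and so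
-- equals a member of A^{u₂} ∪ Ā^{u₂}.  It cannot equal some y ∈ Ā^{u₂}: then x|μ ∈ A^w and
-- y|μ ∈ Ā^w would coincide.  Hence A^{u₁} = A^{u₂}, likewise Ā^{u₁} = Ā^{u₂}, and u₁ = u₂.

module Submission where

open import Defs
open import Data.Empty using (⊥-elim)
open import Data.Product using (Σ; _×_; _,_; proj₁; proj₂)
open import Data.Sum using (_⊎_; inj₁; inj₂; [_,_]′; swap)
open import Relation.Nullary using (¬_)
open import Relation.Unary using (_≐_)
open import Relation.Unary.Properties using (≐-refl; ≐-sym; ≐-trans)
open import Relation.Binary.PropositionalEquality using (_≡_; refl; subst; sym)
open import Relation.Binary.Definitions using (tri<; tri≈; tri>)
open import Induction.WellFounded using (Acc; acc)

module OrdinalProperties (O : CountableOrdinals) where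
  open CountableOrdinals O

  <-irrefl : ∀ {a} → ¬ a < a
  <-irrefl {a} = go (<-wf a)
    where
      go : ∀ {b} → Acc _<_ b → ¬ b < b
      go (acc rs) b<b = go (rs b<b) b<b

  suc≢zero : ∀ {a} → ¬ suc a ≡ zero
  suc≢zero {a} e = zero-min a (subst (a <_) e (<-suc a))

  ≤-<-trans : ∀ {a b c} → a ≤ b → b < c → a < c
  ≤-<-trans (inj₁ a<b) b<c = <-trans a<b b<c
  ≤-<-trans (inj₂ refl) b<c = b<c

  <-≤-trans : ∀ {a b c} → a < b → b ≤ c → a < c
  <-≤-trans a<b (inj₁ b<c) = <-trans a<b b<c
  <-≤-trans a<b (inj₂ refl) = a<b

  suc-mono-< : ∀ {a b} → a < b → suc a < suc b
  suc-mono-< {a} {b} a<b with suc-least a b a<b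
  ... | inj₁ sa<b = <-trans sa<b (<-suc b)
  ... | inj₂ refl = <-suc b

  suc-injective : ∀ {a b} → suc a ≡ suc b → a ≡ b
  suc-injective {a} {b} e with <-tri a b
  ... | tri< a<b _ _ = ⊥-elim (<-irrefl (subst (_< suc b) e (suc-mono-< a<b)))
  ... | tri≈ _ a≡b _ = a≡b
  ... | tri> _ _ b<a = ⊥-elim (<-irrefl (subst (suc b <_) e (suc-mono-< b<a)))

  suc-cancel-≤ : ∀ {a b} → suc a ≤ suc b → a ≤ b
  suc-cancel-≤ (inj₂ e) = inj₂ (suc-injective e)
  suc-cancel-≤ {a} {b} (inj₁ sa<sb) with <-tri a b
  ... | tri< a<b _ _ = inj₁ a<b
  ... | tri≈ _ a≡b _ = inj₂ a≡b
  ... | tri> _ _ b<a = ⊥-elim (<-irrefl (<-trans sa<sb (suc-mono-< b<a)))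

module Restriction (O : CountableOrdinals) (V Ag : Set) where
  open CountableOrdinals O
  open OrdinalProperties O
  open Worlds O V Ag

  _∈⟨_⟩_ : {K : Set} → Raw → Ord → (K → Raw) → Set₁
  x ∈⟨ α ⟩ f = Σ _ λ k → Res α x (f k)

  Image : {K K′ : Set} → Ord → (K → Raw) → (K′ → Raw) → Set₁
  Image α f g = (∀ k → f k ∈⟨ α ⟩ g) × (∀ k′ → Σ _ λ k → Res α (f k) (g k′))

  module _ {α : Ord} {K K′ K″ : Set} {f : K → Raw} {g : K′ → Raw} {h : K″ → Raw} where

    image-unique : (∀ {k k′ k″} → Res α (f k) (g k′) → Res α (f k) (h k″) → Res α (g k′) (h k″)) →
                   Image α f g → Image α f h → Image α g h
    image-unique unique (f↦g , g↤f) (f↦h , h↤f) =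
      (λ k′ → let (k , r) = g↤f k′ ; (k″ , r′) = f↦h k in k″ , unique r r′) ,
      (λ k″ → let (k , r′) = h↤f k″ ; (k′ , r) = f↦g k in k′ , unique r r′)

    image-trans : ∀ {δ} → (∀ {k k′ k″} → Res α (f k) (g k′) → Res δ (g k′) (h k″) → Res δ (f k) (h k″)) →
                  Image α f g → Image δ g h → Image δ f h
    image-trans trans (f↦g , g↤f) (g↦h , h↤g) =
      (λ k → let (k′ , r) = f↦g k ; (k″ , r′) = g↦h k′ in k″ , trans r r′) ,
      (λ k″ → let (k′ , r′) = h↤g k″ ; (k , r) = g↤f k′ in k , trans r r′)

  image-refl : ∀ {α K} {f : K → Raw} → (∀ k → Res α (f k) (f k)) → Image α f f
  image-refl refl′ = (λ k → k , refl′ k) , (λ k → k , refl′ k)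

  pw-node⁻ : ∀ {β I KA fA KB fB} → IsPW (suc β) (node I KA fA KB fB) →
             (∀ a k → IsPW β (fA a k)) × (∀ a k → IsPW β (fB a k))
  pw-node⁻ (pw-suc e pA pB) with suc-injective e
  ... | refl = pA , pB

  res-node⁻ : ∀ {β I KA fA KB fB J KA′ fA′ KB′ fB′} →
              Res (suc β) (node I KA fA KB fB) (node J KA′ fA′ KB′ fB′) →
              I ≐ J × (∀ a → Image β (fA a) (fA′ a)) × (∀ a → Image β (fB a) (fB′ a))
  res-node⁻ (res-suc-node e I≐J imA imB) with suc-injective e
  ... | refl = I≐J , imA , imB

  res-lim⁻ : ∀ {δ v g} → IsLimit δ → Res δ v (seq δ g) → ∀ ε p → Res ε v (g ε p)
  res-lim⁻ lim (res-lim _ r) = r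
  res-lim⁻ lim (res-suc-seq e _ _) = ⊥-elim (proj₂ lim _ e)

  mutual
    res-unique-acc : ∀ {δ γ x b d} → Acc _<_ δ → IsPW γ x → IsPW δ b → IsPW δ d →
                     Res δ x b → Res δ x d → Res δ b d
    res-unique-acc _ _ (pw-zero refl) (pw-suc e _ _) _ _ = ⊥-elim (suc≢zero (sym e))
    res-unique-acc _ _ (pw-zero refl) (pw-lim lim _ _) _ _ = ⊥-elim (proj₁ lim refl)
    res-unique-acc _ _ (pw-zero refl) (pw-zero _) (res-zero-base _ I≐J) (res-zero-base _ I≐J′) =
      res-zero-base refl (≐-trans (≐-sym I≐J) I≐J′)
    res-unique-acc _ _ (pw-zero refl) (pw-zero _) (res-zero-node _ I≐J) (res-zero-node _ I≐J′) =
      res-zero-base refl (≐-trans (≐-sym I≐J) I≐J′)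
    -- coherence at equal levels identifies the components h γ p and h γ p′
    res-unique-acc ac (pw-lim _ pH coh) pb@(pw-zero refl) pd (res-zero-seq _ p r) (res-zero-seq _ p′ r′) =
      res-unique-acc ac (pH zero p) pb pd r
        (res-unique-acc ac (pH zero p′) (pH zero p) pd (coh zero zero p p′ (inj₂ refl)) r′)
    res-unique-acc _ _ (pw-zero refl) (pw-zero _) (res-zero-seq _ _ _) (res-suc-seq e _ _) =
      ⊥-elim (suc≢zero (sym e))
    res-unique-acc _ _ (pw-zero refl) (pw-zero _) (res-suc-seq e _ _) _ = ⊥-elim (suc≢zero (sym e))
    res-unique-acc _ _ (pw-suc refl _ _) (pw-zero e) _ _ = ⊥-elim (suc≢zero e)
    res-unique-acc _ _ (pw-suc refl _ _) (pw-lim lim _ _) _ _ = ⊥-elim (proj₂ lim _ refl)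
    res-unique-acc _ (pw-zero _) (pw-suc refl _ _) (pw-suc _ _ _) () _
    res-unique-acc ac (pw-lim _ pH coh) pb@(pw-suc refl _ _) pd@(pw-suc _ _ _)
                   (res-suc-seq _ p r) (res-suc-seq _ p′ r′) =
      res-unique-acc ac (pH _ p) pb pd r
        (res-unique-acc ac (pH _ p′) (pH _ p) pd (coh _ _ p p′ (inj₂ refl)) r′)
    res-unique-acc (acc rs) (pw-suc _ pxA pxB) (pw-suc refl pbA pbB) pd@(pw-suc _ _ _) r r′
      with pw-node⁻ pd | res-node⁻ r | res-node⁻ r′
    ... | pdA , pdB | I≐J , imA , imB | I≐J′ , imA′ , imB′ =
      res-suc-node refl (≐-trans (≐-sym I≐J) I≐J′)
        (λ a → image-unique (λ {k} {k′} {k″} → res-unique-acc (rs (<-suc _)) (pxA a k) (pbA a k′) (pdA a k″))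
                            (imA a) (imA′ a))
        (λ a → image-unique (λ {k} {k′} {k″} → res-unique-acc (rs (<-suc _)) (pxB a k) (pbB a k′) (pdB a k″))
                            (imB a) (imB′ a))
    res-unique-acc _ _ (pw-lim lim _ _) (pw-zero e) _ _ = ⊥-elim (proj₁ lim e)
    res-unique-acc _ _ (pw-lim lim _ _) (pw-suc e _ _) _ _ = ⊥-elim (proj₂ lim _ e)
    res-unique-acc (acc rs) px pb@(pw-lim lim pbH _) (pw-lim _ pdH _) r r′ =
      res-lim lim λ ε p → res-component-acc (rs p) pb p (inj₂ refl) (pdH ε p)
        (res-unique-acc (rs p) px (pbH ε p) (pdH ε p) (res-lim⁻ lim r ε p) (res-lim⁻ lim r′ ε p))

    res-component-acc : ∀ {δ l h ρ b} → Acc _<_ δ → IsPW l (seq l h) → (p : ρ < l) → δ ≤ ρ →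
                        IsPW δ b → Res δ (h ρ p) b → Res δ (seq l h) b
    res-component-acc ac (pw-lim _ pH coh) p δ≤ρ pb@(pw-zero refl) r =
      res-zero-seq refl p₀ (res-unique-acc ac (pH _ p) (pH zero p₀) pb (coh zero _ p₀ p δ≤ρ) r)
      where p₀ = ≤-<-trans δ≤ρ p
    res-component-acc ac (pw-lim _ pH coh) p δ≤ρ pb@(pw-suc refl _ _) r =
      res-suc-seq refl q (res-unique-acc ac (pH _ p) (pH _ q) pb (coh _ _ q p δ≤ρ) r)
      where q = ≤-<-trans δ≤ρ p
    res-component-acc (acc rs) pl p δ≤ρ (pw-lim lim pbH _) r =
      res-lim lim λ ε q →
        res-component-acc (rs q) pl p (inj₁ (<-≤-trans q δ≤ρ)) (pbH ε q) (res-lim⁻ lim r ε q)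

  res-refl-acc : ∀ {δ b} → Acc _<_ δ → IsPW δ b → Res δ b b
  res-refl-acc _ (pw-zero refl) = res-zero-base refl ≐-refl
  res-refl-acc (acc rs) (pw-suc refl pA pB) =
    res-suc-node refl ≐-refl (λ a → image-refl (λ k → res-refl-acc (rs (<-suc _)) (pA a k)))
                             (λ a → image-refl (λ k → res-refl-acc (rs (<-suc _)) (pB a k)))
  res-refl-acc (acc rs) pb@(pw-lim lim pH _) =
    res-lim lim λ ε p → res-component-acc (rs p) pb p (inj₂ refl) (pH ε p) (res-refl-acc (rs p) (pH ε p))

  res-trans-acc : ∀ {α γ δ x y b} → Acc _<_ δ → IsPW γ x → IsPW δ b → δ ≤ α →
                  Res α x y → Res δ y b → Res δ x b
  res-trans-acc ac px@(pw-lim _ pH _) pb δ≤α (res-suc-seq _ p r) r′ =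
    res-component-acc ac px p δ≤α pb (res-trans-acc ac (pH _ p) pb δ≤α r r′)
  res-trans-acc (acc rs) px (pw-lim _ pbH _) δ≤α r (res-lim lim r′) =
    res-lim lim λ ε p → res-trans-acc (rs p) px (pbH ε p) (inj₁ (<-≤-trans p δ≤α)) r (r′ ε p)
  res-trans-acc _ _ _ _ (res-zero-base _ I≐J) (res-zero-base refl J≐K) =
    res-zero-base refl (≐-trans I≐J J≐K)
  res-trans-acc _ _ _ _ (res-zero-node _ I≐J) (res-zero-base refl J≐K) =
    res-zero-node refl (≐-trans I≐J J≐K)
  res-trans-acc ac (pw-lim _ pH _) pb _ (res-zero-seq _ p r) r′@(res-zero-base refl _) =
    res-zero-seq refl p (res-trans-acc ac (pH zero p) pb (inj₂ refl) r r′)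
  res-trans-acc _ _ _ _ (res-suc-node _ I≐J _ _) (res-zero-node refl J≐K) =
    res-zero-node refl (≐-trans I≐J J≐K)
  res-trans-acc ac px pb _ (res-lim _ r) (res-zero-seq refl p r′) =
    res-trans-acc ac px pb (inj₂ refl) (r zero p) r′
  res-trans-acc ac px pb _ (res-lim _ r) (res-suc-seq _ p r′) =
    res-trans-acc ac px pb (inj₂ refl) (r _ p) r′
  res-trans-acc (acc rs) (pw-suc _ pxA pxB) (pw-suc refl pbA pbB) δ≤α (res-suc-node refl I≐J imA imB) r′
    with res-node⁻ r′
  ... | J≐K , imA′ , imB′ =
    res-suc-node refl (≐-trans I≐J J≐K)
      (λ a → image-trans (λ {k} {_} {k″} → res-trans-acc (rs (<-suc _)) (pxA a k) (pbA a k″) β≤γ)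
                         (imA a) (imA′ a))
      (λ a → image-trans (λ {k} {_} {k″} → res-trans-acc (rs (<-suc _)) (pxB a k) (pbB a k″) β≤γ)
                         (imB a) (imB′ a))
    where β≤γ = suc-cancel-≤ δ≤α

  res-unique : ∀ {δ γ x b d} → IsPW γ x → IsPW δ b → IsPW δ d → Res δ x b → Res δ x d → Res δ b d
  res-unique = res-unique-acc (<-wf _)

  res-trans : ∀ {α γ δ x y b} → IsPW γ x → IsPW δ b → δ ≤ α → Res α x y → Res δ y b → Res δ x b
  res-trans = res-trans-acc (<-wf _)

  res-sym : ∀ {α a b} → IsPW α a → IsPW α b → Res α a b → Res α b a
  res-sym pa pb a≈b = res-unique pa pb pa a≈b (res-refl-acc (<-wf _) pa)

  res-cong : ∀ {α δ x c a b} → IsPW α x → IsPW δ a → IsPW δ b → δ ≤ α →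
             Res α x c → Res δ x a → Res δ c b → Res δ a b
  res-cong px pa pb δ≤α x≈c x↾a c↾b = res-unique px pa pb x↾a (res-trans px pb δ≤α x≈c c↾b)

module Extensions (O : CountableOrdinals) (V Ag : Set) where
  open CountableOrdinals O
  open OrdinalProperties O using (suc≢zero)
  open Worlds O V Ag
  open Restriction O V Ag

  ∈-[,]⁻ : ∀ {α x} {K L : Set} {f : K → Raw} {g : L → Raw} →
           x ∈⟨ α ⟩ [ f , g ]′ → x ∈⟨ α ⟩ f ⊎ x ∈⟨ α ⟩ g
  ∈-[,]⁻ (inj₁ k , r) = inj₁ (k , r)
  ∈-[,]⁻ (inj₂ l , r) = inj₂ (l , r)

  pw-[,] : ∀ {α} {K L : Set} {f : K → Raw} {g : L → Raw} →
           (∀ k → IsPW α (f k)) → (∀ l → IsPW α (g l)) → ∀ i → IsPW α ([ f , g ]′ i)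
  pw-[,] pf pg (inj₁ k) = pf k
  pw-[,] pf pg (inj₂ l) = pg l

  ⊆-via-biworlds : ∀ {α} {K L : Set} {f : K → Raw} {g : L → Raw} →
                   (∀ k → IsPW α (f k)) → (∀ l → IsPW α (g l)) →
                   (∀ k → Σ Raw λ y → Biworld α y × Res α (f k) y) →
                   (∀ y → Biworld α y → Σ L λ l → Res α (g l) y) →
                   ∀ k → f k ∈⟨ α ⟩ g
  ⊆-via-biworlds pf pg f⊆B B⊆g k =
    let (y , by , fk≈y) = f⊆B k ; (l , gl≈y) = B⊆g y by
    in l , res-trans (pf k) (pg l) (inj₂ refl) fk≈y (res-sym (pg l) (proj₁ by) gl≈y)

  ⊆-of-separated : ∀ {α δ} {KS KT KT′ KW KW′ : Set} {S : KS → Raw} {T : KT → Raw} {T′ : KT′ → Raw}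
                     {W : KW → Raw} {W′ : KW′ → Raw} →
                   δ ≤ α → (∀ k → IsPW α (S k)) → (∀ i → IsPW δ (W i)) → (∀ j → IsPW δ (W′ j)) →
                   (∀ k → S k ∈⟨ δ ⟩ W) → (∀ k → T′ k ∈⟨ δ ⟩ W′) → (∀ i j → ¬ Res δ (W i) (W′ j)) →
                   (∀ k → S k ∈⟨ α ⟩ T ⊎ S k ∈⟨ α ⟩ T′) → ∀ k → S k ∈⟨ α ⟩ T
  ⊆-of-separated δ≤α pS pW pW′ S↾W T′↾W′ W∩W′=∅ S⊆T∪T′ k with S⊆T∪T′ k
  ... | inj₁ Sk∈T = Sk∈T
  ... | inj₂ (k′ , Sk≈T′k′) =
    let (i , Sk↾Wi) = S↾W k ; (j , T′k′↾W′j) = T′↾W′ k′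
    in ⊥-elim (W∩W′=∅ i j (res-cong (pS k) (pW i) (pW′ j) δ≤α Sk≈T′k′ Sk↾Wi T′k′↾W′j))

  ⊆-to-image : ∀ {α} {K L : Set} {f : K → Raw} {g : L → Raw} →
               (∀ k → IsPW α (f k)) → (∀ l → IsPW α (g l)) →
               (∀ k → f k ∈⟨ α ⟩ g) → (∀ l → g l ∈⟨ α ⟩ f) → Image α f g
  ⊆-to-image pf pg f⊆g g⊆f =
    f⊆g , λ l → let (k , gl≈fk) = g⊆f l in k , res-sym (pg l) (pf k) gl≈fk

  module _ (μ : Ord) where
    open Stage (suc μ) (Biworld (suc μ))

    extension-⊆ : ∀ {I KA fA KB fB J₁ KA₁ fA₁ KB₁ fB₁ J₂ KA₂ fA₂ KB₂ fB₂} →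
                  let w  = node I KA fA KB fB
                      u₁ = node J₁ KA₁ fA₁ KB₁ fB₁
                      u₂ = node J₂ KA₂ fA₂ KB₂ fB₂ in
                  IsPW (suc μ) w → AgentsDisjoint μ w →
                  IsPW (suc (suc μ)) u₁ → BiSucc u₁ → Res (suc μ) u₁ w →
                  IsPW (suc (suc μ)) u₂ → BiSucc u₂ → Res (suc μ) u₂ w →
                  ∀ a → (∀ k → fA₁ a k ∈⟨ suc μ ⟩ fA₂ a) × (∀ k → fB₁ a k ∈⟨ suc μ ⟩ fB₂ a)
    extension-⊆ pw disjoint pu₁ (bisucc cover₁ _) r₁ pu₂ (bisucc cover₂ _) r₂ a
      with pw-node⁻ pw | pw-node⁻ pu₁ | pw-node⁻ pu₂ | res-node⁻ r₁ | res-node⁻ r₂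
    ... | pA , pB | pA₁ , pB₁ | pA₂ , pB₂ | _ , ↾A₁ , ↾B₁ | _ , ↾A₂ , ↾B₂ =
      ⊆-of-separated μ≤sμ (pA₁ a) (pA a) (pB a) (proj₁ (↾A₁ a)) (proj₁ (↾B₂ a)) (disjoint a)
        (λ k → ∈-[,]⁻ (∪₁⊆∪₂ (inj₁ k))) ,
      ⊆-of-separated μ≤sμ (pB₁ a) (pB a) (pA a) (proj₁ (↾B₁ a)) (proj₁ (↾A₂ a))
        (λ i j Bi≈Aj → disjoint a j i (res-sym (pB a i) (pA a j) Bi≈Aj))
        (λ k → swap (∈-[,]⁻ (∪₁⊆∪₂ (inj₂ k))))
      where
        μ≤sμ = inj₁ (<-suc μ)
        ∪₁⊆∪₂ = ⊆-via-biworlds (pw-[,] (pA₁ a) (pB₁ a)) (pw-[,] (pA₂ a) (pB₂ a))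
                               (proj₂ (cover₁ a)) (proj₁ (cover₂ a))

    extension-unique : ∀ {w u₁ u₂} → IsPW (suc μ) w → AgentsDisjoint μ w →
                       IsPW (suc (suc μ)) u₁ → BiSucc u₁ → Res (suc μ) u₁ w →
                       IsPW (suc (suc μ)) u₂ → BiSucc u₂ → Res (suc μ) u₂ w →
                       Res (suc (suc μ)) u₁ u₂
    extension-unique pw disjoint pu₁ bu₁@(bisucc _ _) r₁@(res-suc-node _ J₁≐I _ _)
                                 pu₂ bu₂@(bisucc _ _) r₂@(res-suc-node _ J₂≐I _ _) =
      res-suc-node refl (≐-trans J₁≐I (≐-sym J₂≐I))
        (λ a → ⊆-to-image (proj₁ (pw-node⁻ pu₁) a) (proj₁ (pw-node⁻ pu₂) a)
                          (proj₁ (u₁⊆u₂ a)) (proj₁ (u₂⊆u₁ a)))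
        (λ a → ⊆-to-image (proj₂ (pw-node⁻ pu₁) a) (proj₂ (pw-node⁻ pu₂) a)
                          (proj₂ (u₁⊆u₂ a)) (proj₂ (u₂⊆u₁ a)))
      where
        u₁⊆u₂ = extension-⊆ pw disjoint pu₁ bu₁ r₁ pu₂ bu₂ r₂
        u₂⊆u₁ = extension-⊆ pw disjoint pu₂ bu₂ r₂ pu₁ bu₁ r₁
    extension-unique _ _ _ (bisucc _ _) (res-zero-node e _) _ _ _ = ⊥-elim (suc≢zero e)
    extension-unique _ _ _ (bisucc _ _) (res-lim lim _) _ _ _ = ⊥-elim (proj₂ lim μ refl)

lemma1 : (O : CountableOrdinals) (V Ag : Set) (μ : CountableOrdinals.Ord O)
         (w : Worlds.Raw O V Ag) →
         Worlds.Biworld O V Ag (CountableOrdinals.suc O μ) w →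
         Worlds.AgentsDisjoint O V Ag μ w →
         Worlds.Completed O V Ag (CountableOrdinals.suc O μ) w
lemma1 O V Ag μ _ bw disjoint (Worlds.Stage.inc u₁ u₂ pu₁ bu₁ r₁ pu₂ bu₂ r₂ u₁≉u₂) =
  u₁≉u₂ (Extensions.extension-unique O V Ag μ (proj₁ bw) disjoint pu₁ bu₁ r₁ pu₂ bu₂ r₂)
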